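{- Let $x$ be a nonzero real number and let $D_x=\{1/b: b\in\mathbb{Q},\ 0<x\leq b \text{ or } x\leq b<0\}$. Then $D_x$ is a supable subset of $\mathbb{Q}$.
   Context: All reasoning is constructive (no law of excluded middle). An ordered set is a set $X$ with a binary relation $<$ satisfying, for all $x,y,z$: asymmetry ($x<y$ implies not $y<x$), cotransitivity ($x<y$ implies $x<z$ or $z<y$), and negative antisymmetry (not $x<y$ and not $y<x$ imply $x=y$). Write $x\leq y$ for "not $y<x$". A subset $S$ of $X$ is almost dense if $x<y$ in $X$ implies $x\leq s<s'\leq y$ for some $s,s'\in S$; bicofinal if each $x\in X$ satisfies $s\leq x\leq s'$ for some $s,s'\in S$; upper order located if $x<y$ in $X$ implies either $x<s$ for some $s\in S$ or $u<y$ for some upper bound $u$ of $S$ in $X$; supable if nonempty, bounded above and upper order located. $X$ is complete if every supable subset has a supremum. $\mathbb{Q}$ is an Archimedean ordered field and the real numbers $\mathbb{R}$ are the completion of $\mathbb{Q}$: a complete ordered set containing (an order-embedded copy of) $\mathbb{Q}$ as an almost dense, bicofinal subset. A real number $x$ is nonzero if $x<0$ or $0<x$. -}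

module Defs where

open import Data.Product using (Σ; Σ-syntax; _×_; ∃; ∃-syntax)
open import Data.Sum using (_⊎_)
open import Relation.Nullary using (¬_)
open import Relation.Unary using (Pred; _∈_)
open import Relation.Binary.PropositionalEquality using (_≡_)
open import Level using (0ℓ)
open import Data.Rational using (ℚ; NonZero; 1/_; 0ℚ)
  renaming (_<_ to _<ℚ_)

module OrderNotions {X : Set} (_<_ : X → X → Set) where

  _≤_ : X → X → Set
  x ≤ y = ¬ (y < x)

  IsUpperBound : Pred X 0ℓ → X → Set
  IsUpperBound S u = ∀ s → s ∈ S → s ≤ u

  Nonempty : Pred X 0ℓ → Set
  Nonempty S = Σ[ s ∈ X ] s ∈ S

  BoundedAbove : Pred X 0ℓ → Set
  BoundedAbove S = Σ[ u ∈ X ] IsUpperBound S u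

  UpperOrderLocated : Pred X 0ℓ → Set
  UpperOrderLocated S = ∀ x y → x < y →
    (Σ[ s ∈ X ] (s ∈ S × x < s)) ⊎ (Σ[ u ∈ X ] (IsUpperBound S u × u < y))

  Supable : Pred X 0ℓ → Set
  Supable S = Nonempty S × BoundedAbove S × UpperOrderLocated S

  IsSupremum : Pred X 0ℓ → X → Set
  IsSupremum S σ = IsUpperBound S σ × (∀ u → IsUpperBound S u → σ ≤ u)

record Reals : Set₁ where
  field
    ℝ : Set
    _<_ : ℝ → ℝ → Set
    asym : ∀ {x y} → x < y → ¬ (y < x)
    cotrans : ∀ {x y} z → x < y → (x < z) ⊎ (z < y)
    neg-antisym : ∀ {x y} → ¬ (x < y) → ¬ (y < x) → x ≡ y
    ι : ℚ → ℝ
    ι-embed₁ : ∀ {p q} → p <ℚ q → ι p < ι q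
    ι-embed₂ : ∀ {p q} → ι p < ι q → p <ℚ q

  open OrderNotions _<_ public

  field
    almostDense : ∀ {x y} → x < y →
      Σ[ s ∈ ℚ ] Σ[ s' ∈ ℚ ] (x ≤ ι s × ι s < ι s' × ι s' ≤ y)
    bicofinal : ∀ x → Σ[ s ∈ ℚ ] Σ[ s' ∈ ℚ ] (ι s ≤ x × x ≤ ι s')
    complete : ∀ (S : Pred ℝ 0ℓ) → Supable S → Σ[ σ ∈ ℝ ] IsSupremum S σ

  NonZeroℝ : ℝ → Set
  NonZeroℝ x = (x < ι 0ℚ) ⊎ (ι 0ℚ < x)

  D : ℝ → Pred ℚ 0ℓ
  D x q = Σ[ b ∈ ℚ ]
    (((ι 0ℚ < x) × (x ≤ ι b)) ⊎ ((x ≤ ι b) × (b <ℚ 0ℚ)))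
    × Σ[ nz ∈ NonZero b ] (q ≡ (1/ b) {{nz}})

module Submission where

-- If x has sign σ, then D x consists of the 1/b with x ≤ b and b of sign σ, and b ↦ 1/b
-- reverses the order on rationals of one sign. So any rational s of sign σ below x gives the
-- upper bound 1/s. For p < q of sign σ, cotransitivity applied to 1/q < 1/p yields either a
-- rational s with 1/q < s ≤ x, hence an upper bound 1/s < q, or a rational b with x ≤ b < 1/p,
-- hence an element 1/b > p. Intervals meeting 0 are easy: for x > 0 all elements are positive,
-- for x < 0 zero is an upper bound.

open import Defs
open import Data.Rational using (ℚ) renaming (_<_ to _<ℚ_)
open import Data.Rational
  using (0ℚ; 1ℚ; _*_; 1/_; NonZero; Positive; positive; negative; >-nonZero; <-nonZero; _<?_)
import Data.Rational.Properties as ℚ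
open import Data.Rational.Properties
  using (*-assoc; *-comm; *-inverseˡ; *-identityʳ; *-monoʳ-<-pos; pos*pos⇒pos; neg*neg⇒pos;
         1/pos⇒pos; 1/neg⇒neg; positive⁻¹; negative⁻¹; nonZero⇒1/nonZero; 1/-involutive)
open import Data.Sign using (Sign)
open import Data.Product using (Σ-syntax; _×_; _,_)
open import Data.Sum using (_⊎_; inj₁; inj₂; map₂; [_,_]′)
open import Data.Empty using (⊥-elim)
open import Function using (id)
open import Relation.Unary using (_∈_)
open import Relation.Nullary using (yes; no)
open import Relation.Binary.PropositionalEquality
  using (_≡_; refl; cong; trans; subst; subst₂; module ≡-Reasoning)

module Q = OrderNotions _<ℚ_

data Signed : Sign → ℚ → Set where
  pos : ∀ {p} → 0ℚ <ℚ p → Signed Sign.+ p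
  neg : ∀ {p} → p <ℚ 0ℚ → Signed Sign.- p

signed⇒nonZero : ∀ {σ p} → Signed σ p → NonZero p
signed⇒nonZero (pos 0<p) = >-nonZero 0<p
signed⇒nonZero (neg p<0) = <-nonZero p<0

1/-signed : ∀ {σ p} .{{_ : NonZero p}} → Signed σ p → Signed σ (1/ p)
1/-signed {p = p} (pos 0<p) = pos (positive⁻¹ _ {{1/pos⇒pos p {{positive 0<p}}}})
1/-signed {p = p} (neg p<0) = neg (negative⁻¹ _ {{1/neg⇒neg p {{negative p<0}}}})

signed*signed⇒pos : ∀ {σ p q} → Signed σ p → Signed σ q → Positive (p * q)
signed*signed⇒pos {p = p} {q} (pos 0<p) (pos 0<q) =
  pos*pos⇒pos p {{positive 0<p}} q {{positive 0<q}}
signed*signed⇒pos {p = p} {q} (neg p<0) (neg q<0) =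
  neg*neg⇒pos p {{negative p<0}} q {{negative q<0}}

*-1/-cancelʳ : ∀ p q .{{_ : NonZero q}} → p * 1/ q * q ≡ p
*-1/-cancelʳ p q = begin
  p * 1/ q * q   ≡⟨ *-assoc p (1/ q) q ⟩
  p * (1/ q * q) ≡⟨ cong (p *_) (*-inverseˡ q) ⟩
  p * 1ℚ         ≡⟨ *-identityʳ p ⟩
  p              ∎
  where open ≡-Reasoning

1/-antimono-< : ∀ {σ p q} .{{_ : NonZero p}} .{{_ : NonZero q}} →
                Signed σ p → Signed σ q → p <ℚ q → 1/ q <ℚ 1/ p
1/-antimono-< {p = p} {q} sp sq p<q = subst₂ _<ℚ_ 1/p*1/q*p≡1/q (*-1/-cancelʳ (1/ p) q)
  (*-monoʳ-<-pos (1/ p * 1/ q) {{signed*signed⇒pos (1/-signed sp) (1/-signed sq)}} p<q)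
  where
  1/p*1/q*p≡1/q : 1/ p * 1/ q * p ≡ 1/ q
  1/p*1/q*p≡1/q = trans (cong (_* p) (*-comm (1/ p) (1/ q))) (*-1/-cancelʳ (1/ q) p)

1/-antimono-≤ : ∀ {σ p q} .{{_ : NonZero p}} .{{_ : NonZero q}} →
                Signed σ p → Signed σ q → p Q.≤ q → (1/ q) Q.≤ (1/ p)
1/-antimono-≤ {p = p} {q} sp sq p≤q 1/p<1/q = p≤q
  (subst₂ _<ℚ_ (1/-involutive q) (1/-involutive p)
    (1/-antimono-< {{nonZero⇒1/nonZero p}} {{nonZero⇒1/nonZero q}}
      (1/-signed sp) (1/-signed sq) 1/p<1/q))

1/-<-swapˡ : ∀ {σ p q} .{{_ : NonZero p}} .{{_ : NonZero q}} →
             Signed σ p → Signed σ q → 1/ p <ℚ q → 1/ q <ℚ p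
1/-<-swapˡ {p = p} sp sq 1/p<q =
  subst (_ <ℚ_) (1/-involutive p) (1/-antimono-< {{nonZero⇒1/nonZero p}} (1/-signed sp) sq 1/p<q)

1/-<-swapʳ : ∀ {σ p q} .{{_ : NonZero p}} .{{_ : NonZero q}} →
             Signed σ p → Signed σ q → p <ℚ 1/ q → q <ℚ 1/ p
1/-<-swapʳ {q = q} sp sq p<1/q =
  subst (_<ℚ _) (1/-involutive q)
    (1/-antimono-< {{_}} {{nonZero⇒1/nonZero q}} sp (1/-signed sq) p<1/q)

module _ (R : Reals) where
  open Reals R

  data Signedℝ : Sign → ℝ → Set where
    pos : ∀ {x} → ι 0ℚ < x → Signedℝ Sign.+ x
    neg : ∀ {x} → x < ι 0ℚ → Signedℝ Sign.- x

  <-≤-trans : ∀ {x y z} → x < y → y ≤ z → x < z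
  <-≤-trans {z = z} x<y y≤z = [ id , (λ z<y → ⊥-elim (y≤z z<y)) ]′ (cotrans z x<y)

  ≤-<-trans : ∀ {x y z} → x ≤ y → y < z → x < z
  ≤-<-trans {x} x≤y y<z = [ (λ y<x → ⊥-elim (x≤y y<x)) , id ]′ (cotrans x y<z)

  <-trans : ∀ {x y z} → x < y → y < z → x < z
  <-trans x<y y<z = <-≤-trans x<y (asym y<z)

  ≤-trans : ∀ {x y z} → x ≤ y → y ≤ z → x ≤ z
  ≤-trans {y = y} x≤y y≤z z<x = [ y≤z , x≤y ]′ (cotrans y z<x)

  ι-cancel-≤ : ∀ {p q} → ι p ≤ ι q → p Q.≤ q
  ι-cancel-≤ ιp≤ιq q<p = ιp≤ιq (ι-embed₁ q<p)

  ι-signed : ∀ {σ r} → Signed σ r → Signedℝ σ (ι r)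
  ι-signed (pos 0<r) = pos (ι-embed₁ 0<r)
  ι-signed (neg r<0) = neg (ι-embed₁ r<0)

  ∃-rational-<-≤ : ∀ {x y} → x < y → Σ[ r ∈ ℚ ] (x < ι r × ι r ≤ y)
  ∃-rational-<-≤ x<y =
    let s , s' , x≤s , s<s' , s'≤y = almostDense x<y in s' , ≤-<-trans x≤s s<s' , s'≤y

  ∃-rational-≤-< : ∀ {x y} → x < y → Σ[ r ∈ ℚ ] (x ≤ ι r × ι r < y)
  ∃-rational-≤-< x<y =
    let s , s' , x≤s , s<s' , s'≤y = almostDense x<y in s , x≤s , <-≤-trans s<s' s'≤y

  signed-between : ∀ {σ x y r} → Signedℝ σ x → Signedℝ σ y → x ≤ ι r → ι r ≤ y → Signed σ r
  signed-between (pos 0<x) _         x≤r _   = pos (ι-embed₂ (<-≤-trans 0<x x≤r))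
  signed-between _         (neg y<0) _   r≤y = neg (ι-embed₂ (≤-<-trans r≤y y<0))

  signed-rational-above : ∀ {σ x} → Signedℝ σ x → Σ[ b ∈ ℚ ] (x ≤ ι b × Signed σ b)
  signed-rational-above {x = x} (pos 0<x) =
    let _ , b , _ , x≤b = bicofinal x in b , x≤b , pos (ι-embed₂ (<-≤-trans 0<x x≤b))
  signed-rational-above (neg x<0) =
    let b , x≤b , b<0 = ∃-rational-≤-< x<0 in b , x≤b , neg (ι-embed₂ b<0)

  signed-rational-below : ∀ {σ x} → Signedℝ σ x → Σ[ s ∈ ℚ ] (ι s ≤ x × Signed σ s)
  signed-rational-below (pos 0<x) =
    let s , 0<s , s≤x = ∃-rational-<-≤ 0<x in s , s≤x , pos (ι-embed₂ 0<s)
  signed-rational-below {x = x} (neg x<0) =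
    let s , _ , s≤x , _ = bicofinal x in s , s≤x , neg (ι-embed₂ (≤-<-trans s≤x x<0))

  D-intro : ∀ {σ x b} → Signedℝ σ x → (sb : Signed σ b) → x ≤ ι b →
            (1/ b) {{signed⇒nonZero sb}} ∈ D x
  D-intro {b = b} (pos 0<x) (pos 0<b) x≤b = b , inj₁ (0<x , x≤b) , >-nonZero 0<b , refl
  D-intro {b = b} (neg _)   (neg b<0) x≤b = b , inj₂ (x≤b , b<0) , <-nonZero b<0 , refl

  D-elim : ∀ {σ x} → Signedℝ σ x → (P : ℚ → Set) →
           (∀ {b} (sb : Signed σ b) → x ≤ ι b → P ((1/ b) {{signed⇒nonZero sb}})) →
           ∀ {q} → q ∈ D x → P q
  D-elim (pos 0<x) _ P-1/ (_ , inj₁ (_ , x≤b) , _ , refl) =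
    P-1/ (pos (ι-embed₂ (<-≤-trans 0<x x≤b))) x≤b
  D-elim (pos 0<x) _ _ (_ , inj₂ (x≤b , b<0) , _ , _) = ⊥-elim (x≤b (<-trans (ι-embed₁ b<0) 0<x))
  D-elim (neg x<0) _ _ (_ , inj₁ (0<x , _) , _ , _) = ⊥-elim (asym x<0 0<x)
  D-elim (neg x<0) _ P-1/ (_ , inj₂ (x≤b , b<0) , _ , refl) = P-1/ (neg b<0) x≤b

  D-signed : ∀ {σ x q} → Signedℝ σ x → q ∈ D x → Signed σ q
  D-signed {σ} xσ = D-elim xσ (Signed σ) (λ sb _ → 1/-signed {{signed⇒nonZero sb}} sb)

  D-upperBound-1/ : ∀ {σ x s} → Signedℝ σ x → (ss : Signed σ s) → ι s ≤ x →
                  Q.IsUpperBound (D x) ((1/ s) {{signed⇒nonZero ss}})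
  D-upperBound-1/ xσ ss s≤x _ = D-elim xσ _ λ sb x≤b →
    1/-antimono-≤ {{signed⇒nonZero ss}} {{signed⇒nonZero sb}} ss sb (ι-cancel-≤ (≤-trans s≤x x≤b))

  D-nonempty : ∀ {σ x} → Signedℝ σ x → Q.Nonempty (D x)
  D-nonempty xσ = let b , x≤b , sb = signed-rational-above xσ in _ , D-intro xσ sb x≤b

  D-boundedAbove : ∀ {σ x} → Signedℝ σ x → Q.BoundedAbove (D x)
  D-boundedAbove xσ = let s , s≤x , ss = signed-rational-below xσ in _ , D-upperBound-1/ xσ ss s≤x

  D-upperOrderLocated-signed : ∀ {σ x p q} → Signedℝ σ x → Signed σ p → Signed σ q → p <ℚ q →
                               (Σ[ s ∈ ℚ ] (s ∈ D x × p <ℚ s)) ⊎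
                               (Σ[ u ∈ ℚ ] (Q.IsUpperBound (D x) u × u <ℚ q))
  D-upperOrderLocated-signed {x = x} xσ sp sq p<q
    with cotrans x (ι-embed₁ (1/-antimono-< {{signed⇒nonZero sp}} {{signed⇒nonZero sq}} sp sq p<q))
  ... | inj₁ 1/q<x =
    let s , 1/q<s , s≤x = ∃-rational-<-≤ 1/q<x
        ss = signed-between (ι-signed (1/-signed {{signed⇒nonZero sq}} sq)) xσ (asym 1/q<s) s≤x
    in inj₂ (_ , D-upperBound-1/ xσ ss s≤x ,
             1/-<-swapˡ {{signed⇒nonZero sq}} {{signed⇒nonZero ss}} sq ss (ι-embed₂ 1/q<s))
  ... | inj₂ x<1/p =
    let b , x≤b , b<1/p = ∃-rational-≤-< x<1/p
        sb = signed-between xσ (ι-signed (1/-signed {{signed⇒nonZero sp}} sp)) x≤b (asym b<1/p)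
    in inj₁ (_ , D-intro xσ sb x≤b ,
             1/-<-swapʳ {{signed⇒nonZero sb}} {{signed⇒nonZero sp}} sb sp (ι-embed₂ b<1/p))

  D-upperOrderLocated : ∀ {σ x} → Signedℝ σ x → Q.UpperOrderLocated (D x)
  D-upperOrderLocated x>0@(pos _) p q p<q with 0ℚ <? p
  ... | yes 0<p = D-upperOrderLocated-signed x>0 (pos 0<p) (pos (ℚ.<-trans 0<p p<q)) p<q
  ... | no p≤0 with D-nonempty x>0
  ...   | s , s∈D with D-signed x>0 s∈D
  ...     | pos 0<s = inj₁ (s , s∈D , ℚ.≤-<-trans (ℚ.≮⇒≥ p≤0) 0<s)
  D-upperOrderLocated {x = x} x<0@(neg _) p q p<q with ℚ.<-dense p<q
  ... | m , p<m , m<q with m <? 0ℚ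
  ...   | yes m<0 = map₂ (λ (u , u-ub , u<m) → u , u-ub , ℚ.<-trans u<m m<q)
                        (D-upperOrderLocated-signed x<0 (neg (ℚ.<-trans p<m m<0)) (neg m<0) p<m)
  ...   | no 0≤m = inj₂ (0ℚ , D-nonPositive , ℚ.≤-<-trans (ℚ.≮⇒≥ 0≤m) m<q)
    where
    D-nonPositive : Q.IsUpperBound (D x) 0ℚ
    D-nonPositive s s∈D with D-signed x<0 s∈D
    ... | neg s<0 = ℚ.<-asym s<0

  D-supable : ∀ {σ x} → Signedℝ σ x → Q.Supable (D x)
  D-supable xσ = D-nonempty xσ , D-boundedAbove xσ , D-upperOrderLocated xσ

lemma19 : (R : Reals) → (x : Reals.ℝ R) → Reals.NonZeroℝ R x →
    OrderNotions.Supable _<ℚ_ (Reals.D R x)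
lemma19 R x (inj₁ x<0) = D-supable R (neg x<0)
lemma19 R x (inj₂ 0<x) = D-supable R (pos 0<x)
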